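{- For every integer $n\ge 0$ there exists an SP-game whose value is the nimber $*n$.
   Context: Games are two-player (Left, Right) short combinatorial games under normal play; value means game value (equivalence class under $G=H$ iff $G-H$ is a second-player win). A strong placement game (SP-game) is a combinatorial game such that: (i) the board is empty at the beginning; (ii) players place pieces on empty vertices of the board according to the rules; (iii) pieces are never moved or removed; (iv) if a position can be reached through some sequence of legal moves, then any sequence of moves leading to it consists of legal moves. Nimbers: $*0=0=\{\,\mid\,\}$ and $*n=\{0,*1,\dots,*(n-1)\mid 0,*1,\dots,*(n-1)\}$. -}

module Defs where

open import Data.Nat using (ℕ; zero; suc; _+_)
open import Data.Fin using (Fin; zero; suc; splitAt; _≟_)
open import Data.Bool using (Bool; true; false; _∧_; if_then_else_)
open import Data.Maybe using (Maybe; just; nothing; is-nothing)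
open import Data.Sum using (_⊎_; inj₁; inj₂; [_,_]′)
open import Data.Product using (Σ; _×_; _,_)
open import Data.Unit using (⊤)
open import Data.List using (List; []; _∷_; length; lookup; filterᵇ; allFin)
open import Relation.Nullary using (¬_; does)
open import Relation.Binary.PropositionalEquality using (_≡_)

data Game : Set where
  game : (nL : ℕ) → (Fin nL → Game) → (nR : ℕ) → (Fin nR → Game) → Game

-_ : Game → Game
- game a L b R = game b (λ j → - R j) a (λ i → - L i)

_⊕_ : Game → Game → Game
g@(game a L b R) ⊕ h@(game c L' d R') =
  game (a + c) (λ i → [ (λ x → L x ⊕ h) , (λ y → g ⊕ L' y) ]′ (splitAt a i))
       (b + d) (λ j → [ (λ x → R x ⊕ h) , (λ y → g ⊕ R' y) ]′ (splitAt b j))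

LeftFirstWins  : Game → Set
RightFirstWins : Game → Set
LeftFirstWins  (game a L b R) = Σ (Fin a) λ i → ¬ RightFirstWins (L i)
RightFirstWins (game a L b R) = Σ (Fin b) λ j → ¬ LeftFirstWins (R j)

SecondPlayerWin : Game → Set
SecondPlayerWin G = ¬ LeftFirstWins G × ¬ RightFirstWins G

_≈G_ : Game → Game → Set
G ≈G H = SecondPlayerWin (G ⊕ (- H))

-- Nimbers: *n = {0,*1,...,*(n-1) | 0,*1,...,*(n-1)}
nim     : ℕ → Game
nimOpts : (n : ℕ) → Fin n → Game
nim n = game n (nimOpts n) n (nimOpts n)
nimOpts (suc n) zero    = nim n
nimOpts (suc n) (suc i) = nimOpts n i

data Player : Set where
  Left Right : Player

-- contents of a vertex: nothing = empty, just p = a piece of player p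
Cell : Set
Cell = Maybe Player

Position : ℕ → Set
Position m = Fin m → Cell

emptyPos : (m : ℕ) → Position m
emptyPos m v = nothing

place : {m : ℕ} → Position m → Fin m → Player → Position m
place P v p w = if does (w ≟ v) then just p else P w

Move : ℕ → Set
Move m = Fin m × Player

run : {m : ℕ} → Position m → List (Move m) → Position m
run P []            = P
run P ((v , p) ∷ s) = run (place P v p) s

IsPlacementSeq : {m : ℕ} → Position m → List (Move m) → Set
IsPlacementSeq P []            = ⊤
IsPlacementSeq P ((v , p) ∷ s) = (P v ≡ nothing) × IsPlacementSeq (place P v p) s

IsLegalSeq : {m : ℕ} → (Position m → Fin m → Player → Bool) →
             Position m → List (Move m) → Set
IsLegalSeq rule P []            = ⊤
IsLegalSeq rule P ((v , p) ∷ s) =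
  (P v ≡ nothing) × (rule P v p ≡ true) × IsLegalSeq rule (place P v p) s

-- A strong placement game: a board with vertex set Fin m, initially empty,
-- and rules saying when player p may place a piece on empty vertex v in
-- position P; pieces are never moved or removed; condition (iv).
record SPGame : Set where
  field
    m    : ℕ
    rule : Position m → Fin m → Player → Bool
    strong : (s t : List (Move m)) →
             IsLegalSeq rule (emptyPos m) s →
             IsPlacementSeq (emptyPos m) t →
             (∀ v → run (emptyPos m) t v ≡ run (emptyPos m) s v) →
             IsLegalSeq rule (emptyPos m) t

-- the game tree of an SP-game from position P (fuel k = number of moves
-- still possible; starting from the empty board, k = m suffices exactly,
-- since each move fills one of the m vertices)
module _ (S : SPGame) where
  open SPGame S

  legalMoves : Position m → Player → List (Fin m)
  legalMoves P p = filterᵇ (λ v → is-nothing (P v) ∧ rule P v p) (allFin m)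

  gameAt : ℕ → Position m → Game
  gameAt zero    P = game 0 (λ ()) 0 (λ ())
  gameAt (suc k) P =
    game (length (legalMoves P Left))
         (λ i → gameAt k (place P (lookup (legalMoves P Left) i) Left))
         (length (legalMoves P Right))
         (λ j → gameAt k (place P (lookup (legalMoves P Right) j) Right))

toGame : SPGame → Game
toGame S = gameAt S (SPGame.m S) (emptyPos (SPGame.m S))

-- In the games built here both players always have the same moves, and a placement is legal iff
-- the resulting set of occupied vertices lies in a fixed family closed under removing pieces; this
-- makes them SP-games.  Such a game equals *g once positions carry labels g obeying the mex rule
-- along single placements.  The family for *(n+1) is the union, glued at the empty position, of
-- the family K for *n and of the cone over a copy of K.  The apex of the cone is an independent
-- move, i.e. a summand *1, so it turns a label g into g xor 1.  From the empty board the cone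
-- offers the value n (take the apex) and K offers every value below n, while every nonempty
-- legal position has value at most n; hence the empty board has value n + 1.

module Submission where

open import Defs
open import Data.Nat using (ℕ; zero; suc; _+_; _<_; _≤_; z≤n; s≤s; _≟_)
open import Data.Nat.Properties
  using (<-cmp; ≤-refl; ≤-reflexive; <⇒≤; <⇒≢; <⇒≱; ≤-pred; n≮0; suc-injective;
         <-≤-trans; ≤-<-trans; m<n⇒m<1+n; m≤n⇒m≤1+n; m<1+n⇒m<n∨m≡n; +-monoʳ-<)
open import Data.Fin as Fin using (Fin; zero; suc; splitAt; _↑ˡ_; _↑ʳ_)
open import Data.Fin.Properties
  using (all?; ↑ˡ-injective; ↑ʳ-injective; splitAt-↑ˡ; splitAt-↑ʳ; splitAt⁻¹-↑ˡ; splitAt⁻¹-↑ʳ)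
open import Data.Bool using (Bool; true; false; T; _∧_; if_then_else_)
open import Data.Bool.Properties using (T-≡; T-∧)
open import Data.List using (List; []; _∷_; lookup; allFin)
open import Data.List.Membership.Propositional.Properties
  using (∈-lookup; ∈-filter⁺; ∈-filter⁻; ∈-allFin)
open import Data.List.Relation.Unary.Any using (index)
open import Data.List.Relation.Unary.Any.Properties using (lookup-index)
open import Data.Unit using (⊤; tt)
open import Data.Maybe using (just; nothing; is-nothing)
open import Data.Product using (Σ; ∃-syntax; _×_; _,_; proj₁; proj₂)
open import Data.Sum using (_⊎_; inj₁; inj₂; [_,_]′)
open import Data.Empty using (⊥; ⊥-elim)
open import Function using (_∘_; _∘₂_; id; flip; case_of_)
open import Function.Bundles using (Equivalence)
open import Function.Definitions using (Injective)
open import Relation.Nullary using (¬_; Dec; yes; no; does)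
open import Relation.Nullary.Decidable using (dec-true; dec-false; T?; _×-dec_; _⊎-dec_)
open import Relation.Binary.Definitions using (tri<; tri≈; tri>)
open import Relation.Binary.PropositionalEquality

nLeft nRight : Game → ℕ
nLeft  (game a _ _ _) = a
nRight (game _ _ b _) = b

leftOption : (G : Game) → Fin (nLeft G) → Game
leftOption (game _ L _ _) = L

rightOption : (G : Game) → Fin (nRight G) → Game
rightOption (game _ _ _ R) = R

leftFirstWins-⊕ˡ : ∀ G H i → ¬ RightFirstWins (leftOption G i ⊕ H) → LeftFirstWins (G ⊕ H)
leftFirstWins-⊕ˡ G@(game a L _ _) H@(game c L′ _ _) i w =
  i ↑ˡ c , subst (¬_ ∘ RightFirstWins ∘ [ (λ x → L x ⊕ H) , (λ y → G ⊕ L′ y) ]′)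
                 (sym (splitAt-↑ˡ a i c)) w

leftFirstWins-⊕ʳ : ∀ G H i → ¬ RightFirstWins (G ⊕ leftOption H i) → LeftFirstWins (G ⊕ H)
leftFirstWins-⊕ʳ G@(game a L _ _) H@(game c L′ _ _) i w =
  a ↑ʳ i , subst (¬_ ∘ RightFirstWins ∘ [ (λ x → L x ⊕ H) , (λ y → G ⊕ L′ y) ]′)
                 (sym (splitAt-↑ʳ a c i)) w

rightFirstWins-⊕ˡ : ∀ G H i → ¬ LeftFirstWins (rightOption G i ⊕ H) → RightFirstWins (G ⊕ H)
rightFirstWins-⊕ˡ G@(game _ _ b R) H@(game _ _ d R′) i w =
  i ↑ˡ d , subst (¬_ ∘ LeftFirstWins ∘ [ (λ x → R x ⊕ H) , (λ y → G ⊕ R′ y) ]′)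
                 (sym (splitAt-↑ˡ b i d)) w

rightFirstWins-⊕ʳ : ∀ G H i → ¬ LeftFirstWins (G ⊕ rightOption H i) → RightFirstWins (G ⊕ H)
rightFirstWins-⊕ʳ G@(game _ _ b R) H@(game _ _ d R′) i w =
  b ↑ʳ i , subst (¬_ ∘ LeftFirstWins ∘ [ (λ x → R x ⊕ H) , (λ y → G ⊕ R′ y) ]′)
                 (sym (splitAt-↑ʳ b d i)) w

leftFirstWins-⊕⁻ : ∀ G H → LeftFirstWins (G ⊕ H) →
  (∃[ i ] ¬ RightFirstWins (leftOption G i ⊕ H)) ⊎ (∃[ i ] ¬ RightFirstWins (G ⊕ leftOption H i))
leftFirstWins-⊕⁻ (game a _ _ _) (game _ _ _ _) (k , w) with splitAt a k
... | inj₁ i = inj₁ (i , w)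
... | inj₂ i = inj₂ (i , w)

rightFirstWins-⊕⁻ : ∀ G H → RightFirstWins (G ⊕ H) →
  (∃[ i ] ¬ LeftFirstWins (rightOption G i ⊕ H)) ⊎ (∃[ i ] ¬ LeftFirstWins (G ⊕ rightOption H i))
rightFirstWins-⊕⁻ (game _ _ b _) (game _ _ _ _) (k , w) with splitAt b k
... | inj₁ i = inj₁ (i , w)
... | inj₂ i = inj₂ (i , w)

nimOpts-nim : ∀ k y → ∃[ j ] j < k × nimOpts k y ≡ nim j
nimOpts-nim (suc k) zero    = k , s≤s ≤-refl , refl
nimOpts-nim (suc k) (suc y) with nimOpts-nim k y
... | j , j<k , eq = j , m<n⇒m<1+n j<k , eq

nimOpts-complete : ∀ k j → j < k → ∃[ y ] nimOpts k y ≡ nim j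
nimOpts-complete (suc k) j j<1+k with <-cmp j k
... | tri< j<k _ _ = let y , eq = nimOpts-complete k j j<k in suc y , eq
... | tri≈ _ refl _ = zero , refl
... | tri> _ _ k<j = ⊥-elim (<⇒≱ j<1+k k<j)

infix 4 _hasNimValue_

_hasNimValue_ : Game → ℕ → Set
game _ L _ R hasNimValue k =
  (∀ i → ∃[ j ] j ≢ k × L i hasNimValue j) ×
  (∀ i → ∃[ j ] j ≢ k × R i hasNimValue j) ×
  (∀ j → j < k → ∃[ i ] L i hasNimValue j) ×
  (∀ j → j < k → ∃[ i ] R i hasNimValue j)

hasNimValue⇒≈nim : ∀ G k → G hasNimValue k → G ≈G nim k
firstPlayerWins-≢ : ∀ G j k → G hasNimValue j → j ≢ k →
  LeftFirstWins (G ⊕ (- nim k)) × RightFirstWins (G ⊕ (- nim k))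
firstPlayerWins-> : ∀ G j k → G hasNimValue j → k < j →
  LeftFirstWins (G ⊕ (- nim k)) × RightFirstWins (G ⊕ (- nim k))

hasNimValue⇒≈nim G@(game _ L _ R) k (leftValues , rightValues , leftReaches , rightReaches) =
  noLeftWin , noRightWin
  where
  noLeftWin : ¬ LeftFirstWins (G ⊕ (- nim k))
  noLeftWin w with leftFirstWins-⊕⁻ G (- nim k) w
  ... | inj₁ (i , lost) =
    let j , j≢k , v = leftValues i in lost (proj₂ (firstPlayerWins-≢ (L i) j k v j≢k))
  ... | inj₂ (y , lost) =
    let j , j<k , eq = nimOpts-nim k y
        i , v = rightReaches j j<k
    in lost (subst (RightFirstWins ∘ (G ⊕_) ∘ -_) (sym eq)
               (rightFirstWins-⊕ˡ G (- nim j) i (proj₁ (hasNimValue⇒≈nim (R i) j v))))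

  noRightWin : ¬ RightFirstWins (G ⊕ (- nim k))
  noRightWin w with rightFirstWins-⊕⁻ G (- nim k) w
  ... | inj₁ (i , lost) =
    let j , j≢k , v = rightValues i in lost (proj₁ (firstPlayerWins-≢ (R i) j k v j≢k))
  ... | inj₂ (y , lost) =
    let j , j<k , eq = nimOpts-nim k y
        i , v = leftReaches j j<k
    in lost (subst (LeftFirstWins ∘ (G ⊕_) ∘ -_) (sym eq)
               (leftFirstWins-⊕ˡ G (- nim j) i (proj₂ (hasNimValue⇒≈nim (L i) j v))))

firstPlayerWins-≢ G j k v j≢k with <-cmp j k
... | tri< j<k _ _ =
  let y , eq = nimOpts-complete k j j<k
      second = hasNimValue⇒≈nim G j v
  in leftFirstWins-⊕ʳ G (- nim k) y
       (subst (¬_ ∘ RightFirstWins ∘ (G ⊕_) ∘ -_) (sym eq) (proj₂ second)) ,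
     rightFirstWins-⊕ʳ G (- nim k) y
       (subst (¬_ ∘ LeftFirstWins ∘ (G ⊕_) ∘ -_) (sym eq) (proj₁ second))
... | tri≈ _ j≡k _ = ⊥-elim (j≢k j≡k)
... | tri> _ _ k<j = firstPlayerWins-> G j k v k<j

firstPlayerWins-> G@(game _ L _ R) j k (_ , _ , leftReaches , rightReaches) k<j =
  let i  , v  = leftReaches k k<j
      i′ , v′ = rightReaches k k<j
  in leftFirstWins-⊕ˡ G (- nim k) i (proj₂ (hasNimValue⇒≈nim (L i) k v)) ,
     rightFirstWins-⊕ˡ G (- nim k) i′ (proj₁ (hasNimValue⇒≈nim (R i′) k v′))

Empty : ∀ {m} → Position m → Set
Empty P = ∀ v → P v ≡ nothing

_⊑_ : ∀ {m} → Position m → Position m → Set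
P ⊑ Q = ∀ v → Q v ≡ nothing → P v ≡ nothing

≗⇒⊑ : ∀ {m} {P Q : Position m} → P ≗ Q → P ⊑ Q
≗⇒⊑ P≗Q v Qv≡nothing = trans (P≗Q v) Qv≡nothing

Empty-⊑ : ∀ {m} {P Q : Position m} → P ⊑ Q → Empty Q → Empty P
Empty-⊑ P⊑Q emptyQ v = P⊑Q v (emptyQ v)

Empty-cong : ∀ {m} {P Q : Position m} → P ≗ Q → Empty Q → Empty P
Empty-cong = Empty-⊑ ∘ ≗⇒⊑

vacant? : (c : Cell) → Dec (c ≡ nothing)
vacant? nothing  = yes refl
vacant? (just _) = no λ ()

empty? : ∀ {m} (P : Position m) → Dec (Empty P)
empty? P = all? (vacant? ∘ P)

place-≡ : ∀ {m} (P : Position m) v p → place P v p v ≡ just p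
place-≡ P v p rewrite dec-true (v Fin.≟ v) refl = refl

place-≢ : ∀ {m} (P : Position m) {v w} p → w ≢ v → place P v p w ≡ P w
place-≢ P {v} {w} p w≢v rewrite dec-false (w Fin.≟ v) w≢v = refl

place-cong : ∀ {m} {P Q : Position m} v p → P ≗ Q → place P v p ≗ place Q v p
place-cong v p P≗Q w with does (w Fin.≟ v)
... | true  = refl
... | false = P≗Q w

⊑-place : ∀ {m} (P : Position m) v p → P ⊑ place P v p
⊑-place P v p w placed-w≡nothing with w Fin.≟ v
... | yes refl = case placed-w≡nothing of λ ()
... | no _     = placed-w≡nothing

place-nonempty : ∀ {m} (P : Position m) v p → ¬ Empty (place P v p)
place-nonempty P v p empty with trans (sym (place-≡ P v p)) (empty v)
... | ()

place-∘-injective : ∀ {k m} {f : Fin k → Fin m} → Injective _≡_ _≡_ f →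
                    ∀ (P : Position m) i p → place P (f i) p ∘ f ≗ place (P ∘ f) i p
place-∘-injective {f = f} f-injective P i p k with k Fin.≟ i
... | yes refl = place-≡ P (f i) p
... | no k≢i   = place-≢ P p (k≢i ∘ f-injective)

place-∘-disjoint : ∀ {k m} {f : Fin k → Fin m} {v} → (∀ k → f k ≢ v) →
                   ∀ (P : Position m) p → place P v p ∘ f ≗ P ∘ f
place-∘-disjoint f≢v P p k = place-≢ P p (f≢v k)

toWitness′ : ∀ {A : Set} (a? : Dec A) → T (does a?) → A
toWitness′ (yes a) _ = a

fromWitness′ : ∀ {A : Set} (a? : Dec A) → A → T (does a?)
fromWitness′ (yes _) _ = tt
fromWitness′ (no ¬a) a = ¬a a

T-is-nothing : ∀ {c : Cell} → T (is-nothing c) → c ≡ nothing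
T-is-nothing {nothing} _ = refl

vacancy : Cell → ℕ
vacancy nothing  = 1
vacancy (just _) = 0

vacancies : ∀ {m} → Position m → ℕ
vacancies {zero}  P = 0
vacancies {suc m} P = vacancy (P zero) + vacancies (P ∘ suc)

vacancies-≤ : ∀ {m} (P : Position m) → vacancies P ≤ m
vacancies-≤ {zero}  P = z≤n
vacancies-≤ {suc m} P with P zero
... | nothing  = s≤s (vacancies-≤ (P ∘ suc))
... | just _   = m≤n⇒m≤1+n (vacancies-≤ (P ∘ suc))

vacancies-place : ∀ {m} (P : Position m) {v} p → P v ≡ nothing → vacancies (place P v p) < vacancies P
vacancies-place P {zero}  p Pv rewrite Pv = ≤-refl
vacancies-place P {suc v} p Pv = +-monoʳ-< (vacancy (P zero)) (vacancies-place (P ∘ suc) p Pv)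

record GrundyComplex (m : ℕ) : Set₁ where
  field
    Legal             : Position m → Set
    legal?            : ∀ P → Dec (Legal P)
    legal-empty       : ∀ {P} → Empty P → Legal P
    legal-⊑           : ∀ {P Q} → P ⊑ Q → Legal Q → Legal P
    grundy            : Position m → ℕ
    grundy-cong       : ∀ {P Q} → P ≗ Q → grundy P ≡ grundy Q
    grundy-move-≢     : ∀ {P v p} → P v ≡ nothing → Legal (place P v p) → grundy (place P v p) ≢ grundy P
    grundy-move-reach : ∀ {P j} p → Legal P → j < grundy P →
                        ∃[ v ] P v ≡ nothing × Legal (place P v p) × grundy (place P v p) ≡ j

  legal-cong : ∀ {P Q} → P ≗ Q → Legal Q → Legal P
  legal-cong = legal-⊑ ∘ ≗⇒⊑

module PlacementGame {m} (K : GrundyComplex m) where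
  open GrundyComplex K

  legalAfter : Position m → Fin m → Player → Bool
  legalAfter P v p = does (legal? (place P v p))

  legal-run : ∀ {P} s → Legal P → IsLegalSeq legalAfter P s → Legal (run P s)
  legal-run []            legalP _                    = legalP
  legal-run ((v , p) ∷ s) _      (_ , legal-v , rest) =
    legal-run s (toWitness′ (legal? _) (Equivalence.from T-≡ legal-v)) rest

  ⊑-run : ∀ P (s : List (Move m)) → P ⊑ run P s
  ⊑-run P []            w = id
  ⊑-run P ((v , p) ∷ s) w = ⊑-place P v p w ∘ ⊑-run (place P v p) s w

  isLegalSeq : ∀ {P} t → IsPlacementSeq P t → Legal (run P t) → IsLegalSeq legalAfter P t
  isLegalSeq []            _           _     = tt
  isLegalSeq {P} ((v , p) ∷ t) (Pv , rest) legal =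
    Pv , dec-true (legal? _) (legal-⊑ (⊑-run (place P v p) t) legal) , isLegalSeq t rest legal

  spGame : SPGame
  spGame = record
    { m      = m
    ; rule   = legalAfter
    ; strong = λ s t legal-s placement-t same →
        isLegalSeq t placement-t (legal-cong same (legal-run s (legal-empty λ _ → refl) legal-s))
    }

  private
    legalMove? : Position m → Player → Fin m → Bool
    legalMove? P p v = is-nothing (P v) ∧ legalAfter P v p

  legalMove-valid : ∀ P p i → let v = lookup (legalMoves spGame P p) i in
                    P v ≡ nothing × Legal (place P v p)
  legalMove-valid P p i
    with _ , valid ← ∈-filter⁻ (T? ∘ legalMove? P p) {xs = allFin m} (∈-lookup {xs = legalMoves spGame P p} i)
    with vacant , legal ← Equivalence.to T-∧ valid
    = T-is-nothing vacant , toWitness′ (legal? _) legal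

  legalMove-index : ∀ {P v} p → P v ≡ nothing → Legal (place P v p) →
                    ∃[ i ] lookup (legalMoves spGame P p) i ≡ v
  legalMove-index {P} {v} p Pv legal =
    let v∈moves = ∈-filter⁺ (T? ∘ legalMove? P p) (∈-allFin v)
                    (Equivalence.from T-∧ (subst (T ∘ is-nothing) (sym Pv) tt , fromWitness′ (legal? _) legal))
    in index v∈moves , sym (lookup-index v∈moves)

  gameAt-hasNimValue : ∀ k P → Legal P → vacancies P ≤ k → gameAt spGame k P hasNimValue grundy P
  gameAt-hasNimValue zero P legalP noVacancy =
    (λ ()) , (λ ()) , (λ j → ⊥-elim ∘ noMove j) , (λ j → ⊥-elim ∘ noMove j)
    where
    noMove : ∀ j → j < grundy P → ⊥
    noMove j j<g =
      let v , Pv , _ = grundy-move-reach Left legalP j<g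
      in n≮0 (<-≤-trans (vacancies-place P Left Pv) noVacancy)
  gameAt-hasNimValue (suc k) P legalP vacancies≤ =
    options Left , options Right , reaches Left , reaches Right
    where
    next : ∀ {v} p → P v ≡ nothing → Legal (place P v p) →
           gameAt spGame k (place P v p) hasNimValue grundy (place P v p)
    next p Pv legal =
      gameAt-hasNimValue k _ legal (≤-pred (<-≤-trans (vacancies-place P p Pv) vacancies≤))

    options : ∀ p i → let v = lookup (legalMoves spGame P p) i in
              ∃[ j ] j ≢ grundy P × gameAt spGame k (place P v p) hasNimValue j
    options p i = let Pv , legal = legalMove-valid P p i in
                  _ , grundy-move-≢ Pv legal , next p Pv legal

    reaches : ∀ p j → j < grundy P → ∃[ i ] let v = lookup (legalMoves spGame P p) i in
              gameAt spGame k (place P v p) hasNimValue j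
    reaches p j j<g =
      let v , Pv , legal , g≡j = grundy-move-reach p legalP j<g
          i , lookup≡v         = legalMove-index p Pv legal
      in i , subst (λ w → gameAt spGame k (place P w p) hasNimValue j) (sym lookup≡v)
                   (subst (gameAt spGame k (place P v p) hasNimValue_) g≡j (next p Pv legal))

  toGame≈nim : toGame spGame ≈G nim (grundy (emptyPos m))
  toGame≈nim = hasNimValue⇒≈nim _ _
    (gameAt-hasNimValue m (emptyPos m) (legal-empty λ _ → refl) (vacancies-≤ (emptyPos m)))

xor1 : ℕ → ℕ
xor1 zero          = 1
xor1 (suc zero)    = 0
xor1 (suc (suc n)) = suc (suc (xor1 n))

xor1-involutive : ∀ n → xor1 (xor1 n) ≡ n
xor1-involutive zero          = refl
xor1-involutive (suc zero)    = refl
xor1-involutive (suc (suc n)) = cong (2 +_) (xor1-involutive n)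

xor1-injective : ∀ {a b} → xor1 a ≡ xor1 b → a ≡ b
xor1-injective {a} {b} eq =
  trans (sym (xor1-involutive a)) (trans (cong xor1 eq) (xor1-involutive b))

xor1-≢ : ∀ n → xor1 n ≢ n
xor1-≢ zero          ()
xor1-≢ (suc zero)    ()
xor1-≢ (suc (suc n)) eq = xor1-≢ n (suc-injective (suc-injective eq))

xor1-≤ : ∀ n → xor1 n ≤ suc n
xor1-≤ zero          = ≤-refl
xor1-≤ (suc zero)    = z≤n
xor1-≤ (suc (suc n)) = s≤s (s≤s (xor1-≤ n))

<-xor1⇒xor1-< : ∀ {j g} → j < xor1 g → j ≢ g → xor1 j < g
<-xor1⇒xor1-< {g = zero}        (s≤s z≤n)      j≢g = ⊥-elim (j≢g refl)
<-xor1⇒xor1-< {zero}      {suc (suc g)} _              _   = s≤s (s≤s z≤n)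
<-xor1⇒xor1-< {suc zero}  {suc (suc g)} _              _   = s≤s z≤n
<-xor1⇒xor1-< {suc (suc j)} {suc (suc g)} (s≤s (s≤s j<)) j≢g =
  s≤s (s≤s (<-xor1⇒xor1-< j< (j≢g ∘ cong (2 +_))))

coneGrundy : Cell → ℕ → ℕ
coneGrundy nothing  g = xor1 g
coneGrundy (just _) g = g

coneGrundy-injective : ∀ c {a b} → coneGrundy c a ≡ coneGrundy c b → a ≡ b
coneGrundy-injective nothing  = xor1-injective
coneGrundy-injective (just _) = id

module Cone {m} (K : GrundyComplex m) where
  open GrundyComplex K

  base : Position (suc m) → Position m
  base P = P ∘ suc

  coneGrundyAt : Position (suc m) → ℕ
  coneGrundyAt P = coneGrundy (P zero) (grundy (base P))

  move-≢ : ∀ {P v p} → P v ≡ nothing → Legal (base (place P v p)) →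
           coneGrundyAt (place P v p) ≢ coneGrundyAt P
  move-≢ {P} {zero}  Pv _     rewrite Pv = xor1-≢ _ ∘ sym
  move-≢ {P} {suc _} Pv legal = grundy-move-≢ Pv legal ∘ coneGrundy-injective (P zero)

  move-reach : ∀ {P j} p → Legal (base P) → j < coneGrundyAt P →
               ∃[ v ] P v ≡ nothing × Legal (base (place P v p)) × coneGrundyAt (place P v p) ≡ j
  move-reach {P} {j} p legal j< with P zero in apex
  ... | just _ = let i , Pi , legal′ , g≡j = grundy-move-reach p legal j< in suc i , Pi , legal′ , g≡j
  ... | nothing with j ≟ grundy (base P)
  ...   | yes refl = zero , apex , legal , refl
  ...   | no j≢g =
    let i , Pi , legal′ , g≡xor1j = grundy-move-reach p legal (<-xor1⇒xor1-< j< j≢g)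
    in suc i , Pi , legal′ , trans (cong xor1 g≡xor1j) (xor1-involutive j)

  cone : GrundyComplex (suc m)
  cone = record
    { Legal             = Legal ∘ base
    ; legal?            = legal? ∘ base
    ; legal-empty       = λ empty → legal-empty (empty ∘ suc)
    ; legal-⊑           = λ P⊑Q → legal-⊑ (P⊑Q ∘ suc)
    ; grundy            = coneGrundyAt
    ; grundy-cong       = λ P≗Q → cong₂ coneGrundy (P≗Q zero) (grundy-cong (P≗Q ∘ suc))
    ; grundy-move-≢     = λ {P} {v} {p} → move-≢ {P} {v} {p}
    ; grundy-move-reach = move-reach
    }

module _ {m} (K : GrundyComplex m) where
  open GrundyComplex K

  NonemptyBelow : ℕ → Set
  NonemptyBelow c = ∀ {P} → Legal P → ¬ Empty P → grundy P < c

  ReachesFromEmpty : ℕ → Player → Set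
  ReachesFromEmpty j p = ∃[ v ] Legal (place (emptyPos m) v p) × grundy (place (emptyPos m) v p) ≡ j

  grundyOr : Position m → ℕ → ℕ
  grundyOr X d = if does (empty? X) then d else grundy X

  grundyOr-empty : ∀ {X d} → Empty X → grundyOr X d ≡ d
  grundyOr-empty {X} empty rewrite dec-true (empty? X) empty = refl

  grundyOr-nonempty : ∀ {X d} → ¬ Empty X → grundyOr X d ≡ grundy X
  grundyOr-nonempty {X} nonempty rewrite dec-false (empty? X) nonempty = refl

  grundyOr-cong : ∀ {X Y d d′} → X ≗ Y → d ≡ d′ → grundyOr X d ≡ grundyOr Y d′
  grundyOr-cong {X} {Y} X≗Y refl = case empty? X of λ where
    (yes emptyX)   → trans (grundyOr-empty emptyX) (sym (grundyOr-empty (Empty-cong (sym ∘ X≗Y) emptyX)))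
    (no nonemptyX) → trans (grundyOr-nonempty nonemptyX)
                       (trans (grundy-cong X≗Y) (sym (grundyOr-nonempty (nonemptyX ∘ Empty-cong X≗Y))))

  grundyOr-move-≢ : ∀ {X i p d} → X i ≡ nothing → Legal (place X i p) →
                    (Empty X → grundy (place X i p) ≢ d) → grundy (place X i p) ≢ grundyOr X d
  grundyOr-move-≢ {X} Xi legal fromEmpty = case empty? X of λ where
    (yes emptyX)   → fromEmpty emptyX ∘ flip trans (grundyOr-empty emptyX)
    (no nonemptyX) → grundy-move-≢ Xi legal ∘ flip trans (grundyOr-nonempty nonemptyX)

↑ˡ≢↑ʳ : ∀ {m₁ m₂} (i : Fin m₁) (k : Fin m₂) → i ↑ˡ m₂ ≢ m₁ ↑ʳ k
↑ˡ≢↑ʳ {m₁} {m₂} i k eq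
  with () ← trans (sym (splitAt-↑ˡ m₁ i m₂)) (trans (cong (splitAt m₁) eq) (splitAt-↑ʳ m₁ m₂ k))

data Side (m₁ m₂ : ℕ) : Fin (m₁ + m₂) → Set where
  inLeft  : ∀ i → Side m₁ m₂ (i ↑ˡ m₂)
  inRight : ∀ i → Side m₁ m₂ (m₁ ↑ʳ i)

side : ∀ m₁ m₂ v → Side m₁ m₂ v
side m₁ m₂ v with splitAt m₁ v in eq
... | inj₁ i = subst (Side m₁ m₂) (splitAt⁻¹-↑ˡ eq) (inLeft i)
... | inj₂ i = subst (Side m₁ m₂) (splitAt⁻¹-↑ʳ eq) (inRight i)

module Wedge {m₁ m₂} (K₁ : GrundyComplex m₁) (K₂ : GrundyComplex m₂) (c : ℕ)
  (below₁ : NonemptyBelow K₁ c) (below₂ : NonemptyBelow K₂ c)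
  (reach : ∀ {j} p → j < c → ReachesFromEmpty K₁ j p ⊎ ReachesFromEmpty K₂ j p) where

  private
    module K₁ = GrundyComplex K₁
    module K₂ = GrundyComplex K₂

  left : Position (m₁ + m₂) → Position m₁
  left P = P ∘ (_↑ˡ m₂)

  right : Position (m₁ + m₂) → Position m₂
  right P = P ∘ (m₁ ↑ʳ_)

  Legal : Position (m₁ + m₂) → Set
  Legal P = (K₁.Legal (left P) × Empty (right P)) ⊎ (Empty (left P) × K₂.Legal (right P))

  grundy : Position (m₁ + m₂) → ℕ
  grundy P = grundyOr K₁ (left P) (grundyOr K₂ (right P) c)

  legal-⊑ : ∀ {P Q} → P ⊑ Q → Legal Q → Legal P
  legal-⊑ P⊑Q (inj₁ (legal , emptyR)) =
    inj₁ (K₁.legal-⊑ (P⊑Q ∘ (_↑ˡ m₂)) legal , Empty-⊑ (P⊑Q ∘ (m₁ ↑ʳ_)) emptyR)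
  legal-⊑ P⊑Q (inj₂ (emptyL , legal)) =
    inj₂ (Empty-⊑ (P⊑Q ∘ (_↑ˡ m₂)) emptyL , K₂.legal-⊑ (P⊑Q ∘ (m₁ ↑ʳ_)) legal)

  grundy-cong : ∀ {P Q} → P ≗ Q → grundy P ≡ grundy Q
  grundy-cong P≗Q = grundyOr-cong K₁ (P≗Q ∘ (_↑ˡ m₂)) (grundyOr-cong K₂ (P≗Q ∘ (m₁ ↑ʳ_)) refl)

  empty-split : ∀ {P} → Empty (left P) → Empty (right P) → Empty P
  empty-split {P} emptyL emptyR v with side m₁ m₂ v
  ... | inLeft i  = emptyL i
  ... | inRight i = emptyR i

  left-placeˡ : ∀ P i p → left (place P (i ↑ˡ m₂) p) ≗ place (left P) i p
  left-placeˡ = place-∘-injective (↑ˡ-injective m₂ _ _)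

  right-placeˡ : ∀ P i p → right (place P (i ↑ˡ m₂) p) ≗ right P
  right-placeˡ P i = place-∘-disjoint (λ k → ↑ˡ≢↑ʳ i k ∘ sym) P

  left-placeʳ : ∀ P i p → left (place P (m₁ ↑ʳ i) p) ≗ left P
  left-placeʳ P i = place-∘-disjoint (λ k → ↑ˡ≢↑ʳ k i) P

  right-placeʳ : ∀ P i p → right (place P (m₁ ↑ʳ i) p) ≗ place (right P) i p
  right-placeʳ = place-∘-injective (↑ʳ-injective m₁ _ _)

  left-placeˡ-nonempty : ∀ P i p → ¬ Empty (left (place P (i ↑ˡ m₂) p))
  left-placeˡ-nonempty P i p = place-nonempty (left P) i p ∘ Empty-cong (sym ∘ left-placeˡ P i p)

  right-placeʳ-nonempty : ∀ P i p → ¬ Empty (right (place P (m₁ ↑ʳ i) p))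
  right-placeʳ-nonempty P i p = place-nonempty (right P) i p ∘ Empty-cong (sym ∘ right-placeʳ P i p)

  moveˡ : ∀ {P i p} → K₁.Legal (place (left P) i p) → Empty (right P) →
          Legal (place P (i ↑ˡ m₂) p) × grundy (place P (i ↑ˡ m₂) p) ≡ K₁.grundy (place (left P) i p)
  moveˡ {P} {i} {p} legal emptyR =
    inj₁ (K₁.legal-cong (left-placeˡ P i p) legal , Empty-cong (right-placeˡ P i p) emptyR) ,
    trans (grundyOr-nonempty K₁ (left-placeˡ-nonempty P i p)) (K₁.grundy-cong (left-placeˡ P i p))

  moveʳ : ∀ {P i p} → Empty (left P) → K₂.Legal (place (right P) i p) →
          Legal (place P (m₁ ↑ʳ i) p) × grundy (place P (m₁ ↑ʳ i) p) ≡ K₂.grundy (place (right P) i p)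
  moveʳ {P} {i} {p} emptyL legal =
    inj₂ (Empty-cong (left-placeʳ P i p) emptyL , K₂.legal-cong (right-placeʳ P i p) legal) ,
    trans (grundyOr-empty K₁ (Empty-cong (left-placeʳ P i p) emptyL))
          (trans (grundyOr-nonempty K₂ (right-placeʳ-nonempty P i p)) (K₂.grundy-cong (right-placeʳ P i p)))

  moveˡ⁻¹ : ∀ {P i p} → Legal (place P (i ↑ˡ m₂) p) → K₁.Legal (place (left P) i p) × Empty (right P)
  moveˡ⁻¹ {P} {i} {p} (inj₁ (legal , emptyR)) =
    K₁.legal-cong (sym ∘ left-placeˡ P i p) legal , Empty-cong (sym ∘ right-placeˡ P i p) emptyR
  moveˡ⁻¹ {P} {i} {p} (inj₂ (emptyL , _)) = ⊥-elim (left-placeˡ-nonempty P i p emptyL)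

  moveʳ⁻¹ : ∀ {P i p} → Legal (place P (m₁ ↑ʳ i) p) → Empty (left P) × K₂.Legal (place (right P) i p)
  moveʳ⁻¹ {P} {i} {p} (inj₁ (_ , emptyR)) = ⊥-elim (right-placeʳ-nonempty P i p emptyR)
  moveʳ⁻¹ {P} {i} {p} (inj₂ (emptyL , legal)) =
    Empty-cong (sym ∘ left-placeʳ P i p) emptyL , K₂.legal-cong (sym ∘ right-placeʳ P i p) legal

  move-≢ : ∀ {P v p} → P v ≡ nothing → Legal (place P v p) → grundy (place P v p) ≢ grundy P
  move-≢ {P} {v} Pv legal with side m₁ m₂ v
  ... | inLeft i =
    let legal′ , emptyR = moveˡ⁻¹ {P} legal in
    grundyOr-move-≢ K₁ Pv legal′ (λ _ → <⇒≢ (below₁ legal′ (place-nonempty (left P) i _)))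
      ∘ flip trans (cong (grundyOr K₁ (left P)) (grundyOr-empty K₂ emptyR))
      ∘ trans (sym (proj₂ (moveˡ {P} legal′ emptyR)))
  ... | inRight i =
    let emptyL , legal′ = moveʳ⁻¹ {P} legal in
    grundyOr-move-≢ K₂ Pv legal′ (λ _ → <⇒≢ (below₂ legal′ (place-nonempty (right P) i _)))
      ∘ flip trans (grundyOr-empty K₁ emptyL)
      ∘ trans (sym (proj₂ (moveʳ {P} emptyL legal′)))

  Reaches : Position (m₁ + m₂) → ℕ → Player → Set
  Reaches P j p = ∃[ v ] P v ≡ nothing × Legal (place P v p) × grundy (place P v p) ≡ j

  reachˡ : ∀ {P j} p → K₁.Legal (left P) → Empty (right P) → j < K₁.grundy (left P) → Reaches P j p
  reachˡ {P} p legal emptyR j<g =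
    let i , Pi , legal′ , g≡j = K₁.grundy-move-reach p legal j<g
        legal″ , g≡g′ = moveˡ {P} legal′ emptyR
    in i ↑ˡ m₂ , Pi , legal″ , trans g≡g′ g≡j

  reachʳ : ∀ {P j} p → Empty (left P) → K₂.Legal (right P) → j < K₂.grundy (right P) → Reaches P j p
  reachʳ {P} p emptyL legal j<g =
    let i , Pi , legal′ , g≡j = K₂.grundy-move-reach p legal j<g
        legal″ , g≡g′ = moveʳ {P} emptyL legal′
    in m₁ ↑ʳ i , Pi , legal″ , trans g≡g′ g≡j

  reach-empty : ∀ {P j} p → Empty (left P) → Empty (right P) → j < c → Reaches P j p
  reach-empty {P} p emptyL emptyR j<c with reach p j<c
  ... | inj₁ (v , legal , g≡j) =
    let legal′ , g≡g′ = moveˡ {P} (K₁.legal-cong (place-cong v p emptyL) legal) emptyR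
    in v ↑ˡ m₂ , emptyL v , legal′ , trans g≡g′ (trans (K₁.grundy-cong (place-cong v p emptyL)) g≡j)
  ... | inj₂ (v , legal , g≡j) =
    let legal′ , g≡g′ = moveʳ {P} emptyL (K₂.legal-cong (place-cong v p emptyR) legal)
    in m₁ ↑ʳ v , emptyR v , legal′ , trans g≡g′ (trans (K₂.grundy-cong (place-cong v p emptyR)) g≡j)

  move-reach : ∀ {P j} p → Legal P → j < grundy P → Reaches P j p
  move-reach {P} p (inj₁ (legal , emptyR)) j<g
    rewrite grundyOr-empty K₂ {d = c} emptyR = case empty? (left P) of λ where
      (yes emptyL)   → reach-empty {P} p emptyL emptyR (subst (_ <_) (grundyOr-empty K₁ emptyL) j<g)
      (no nonemptyL) → reachˡ {P} p legal emptyR (subst (_ <_) (grundyOr-nonempty K₁ nonemptyL) j<g)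
  move-reach {P} p (inj₂ (emptyL , legal)) j<g
    rewrite grundyOr-empty K₁ {d = grundyOr K₂ (right P) c} emptyL = case empty? (right P) of λ where
      (yes emptyR)   → reach-empty {P} p emptyL emptyR (subst (_ <_) (grundyOr-empty K₂ emptyR) j<g)
      (no nonemptyR) → reachʳ {P} p emptyL legal (subst (_ <_) (grundyOr-nonempty K₂ nonemptyR) j<g)

  wedge : GrundyComplex (m₁ + m₂)
  wedge = record
    { Legal             = Legal
    ; legal?            = λ P → (K₁.legal? (left P) ×-dec empty? (right P)) ⊎-dec
                                (empty? (left P) ×-dec K₂.legal? (right P))
    ; legal-empty       = λ empty → inj₁ (K₁.legal-empty (empty ∘ (_↑ˡ m₂)) , empty ∘ (m₁ ↑ʳ_))
    ; legal-⊑           = legal-⊑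
    ; grundy            = grundy
    ; grundy-cong       = grundy-cong
    ; grundy-move-≢     = λ {P} {v} {p} → move-≢ {P} {v} {p}
    ; grundy-move-reach = move-reach
    }

  grundy-empty : ∀ {P} → Empty P → grundy P ≡ c
  grundy-empty empty =
    trans (grundyOr-empty K₁ (empty ∘ (_↑ˡ m₂))) (grundyOr-empty K₂ (empty ∘ (m₁ ↑ʳ_)))

  grundy-below : NonemptyBelow wedge c
  grundy-below (inj₁ (legal , emptyR)) nonempty =
    let nonemptyL = nonempty ∘ flip empty-split emptyR in
    subst (_< c) (sym (grundyOr-nonempty K₁ nonemptyL)) (below₁ legal nonemptyL)
  grundy-below (inj₂ (emptyL , legal)) nonempty =
    let nonemptyR = nonempty ∘ empty-split emptyL in
    subst (_< c) (sym (trans (grundyOr-empty K₁ emptyL) (grundyOr-nonempty K₂ nonemptyR)))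
          (below₂ legal nonemptyR)

record NimComplex (n : ℕ) : Set₁ where
  field
    {size}       : ℕ
    complex      : GrundyComplex size
    grundy-empty : ∀ {P} → Empty P → GrundyComplex.grundy complex P ≡ n
    grundy-below : NonemptyBelow complex n

  open GrundyComplex complex

  grundy-≤ : ∀ {P} → Legal P → grundy P ≤ n
  grundy-≤ {P} legal = case empty? P of λ where
    (yes empty)   → ≤-reflexive (grundy-empty empty)
    (no nonempty) → <⇒≤ (grundy-below legal nonempty)

  cone-grundy-below : NonemptyBelow (Cone.cone complex) (suc n)
  cone-grundy-below {P} legal nonempty with P zero in apex
  ... | just _  = s≤s (grundy-≤ legal)
  ... | nothing = ≤-<-trans (xor1-≤ _) (s≤s (grundy-below legal (nonempty ∘ emptyCone)))
    where
    emptyCone : Empty (P ∘ suc) → Empty P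
    emptyCone emptyBase zero    = apex
    emptyCone emptyBase (suc v) = emptyBase v

  cone-reaches : ∀ p → ReachesFromEmpty (Cone.cone complex) n p
  cone-reaches p = zero , legal-empty (λ _ → refl) , grundy-empty (λ _ → refl)

  reaches-below : ∀ {j} p → j < n → ReachesFromEmpty complex j p
  reaches-below p j<n =
    let v , _ , legal , g≡j = grundy-move-reach p (legal-empty (λ _ → refl))
                                (subst (_ <_) (sym (grundy-empty (λ _ → refl))) j<n)
    in v , legal , g≡j

nimComplex : ∀ n → NimComplex n
nimComplex zero = record
  { size         = 0
  ; complex      = record
      { Legal             = λ _ → ⊤
      ; legal?            = λ _ → yes tt
      ; legal-empty       = λ _ → tt
      ; legal-⊑           = λ _ _ → tt
      ; grundy            = λ _ → 0
      ; grundy-cong       = λ _ → refl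
      ; grundy-move-≢     = λ { {v = ()} }
      ; grundy-move-reach = λ _ _ ()
      }
  ; grundy-empty = λ _ → refl
  ; grundy-below = λ _ nonempty → ⊥-elim (nonempty λ ())
  }
nimComplex (suc n) = record
  { complex      = wedge
  ; grundy-empty = grundy-empty
  ; grundy-below = grundy-below
  }
  where
  open NimComplex (nimComplex n) using (complex; cone-grundy-below; cone-reaches; reaches-below)
    renaming (grundy-below to below)
  reach : ∀ {j} p → j < suc n → ReachesFromEmpty (Cone.cone complex) j p ⊎ ReachesFromEmpty complex j p
  reach p j<1+n with m<1+n⇒m<n∨m≡n j<1+n
  ... | inj₁ j<n  = inj₂ (reaches-below p j<n)
  ... | inj₂ refl = inj₁ (cone-reaches p)
  open Wedge (Cone.cone complex) complex (suc n) cone-grundy-below (m<n⇒m<1+n ∘₂ below) reach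

mainTheorem12 : (n : ℕ) → Σ SPGame λ G → toGame G ≈G nim n
mainTheorem12 n = spGame , subst (toGame spGame ≈G_ ∘ nim) (grundy-empty λ _ → refl) toGame≈nim
  where
  open NimComplex (nimComplex n)
  open PlacementGame complex
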